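{- In the Restricted Grid Scheduling setting, for any set of items and any sequence of bins, there exists an optimal thrifty packing that contains no bad bin.
   Context: Restricted Grid Scheduling setting: $S>1$ is an integer, $L=2S-1$, $M=4S-3$; every item has size $S$ or $L$, and the bins form a finite sequence of integer sizes in $[S,M]$ (sufficient for all items to be packed). A packing assigns every item to a bin with total item size in each bin at most the bin size; the cost is the sum of sizes of bins receiving at least one item. A packing is valid if each empty bin is smaller than every item packed in a later bin; it is optimal if it is valid and of minimum cost among valid packings. A bin is wasteful if its empty space is at least as large as some item packed in a later bin; a packing is thrifty if no bin is wasteful. A bin used in a packing is bad if it contains at least one item of size $S$, its empty space is at least $L-S$, and some item of size $L$ is packed in a later bin (i.e., it occurs while items of size $L$ remain). -}

module Defs where

open import Data.Nat using (ℕ; zero; suc; _+_; _*_; _∸_; _≤_; _<_)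
open import Data.Fin using (Fin; zero; suc)
import Data.Fin
import Data.Empty
open import Data.Fin.Properties using (any?)
import Data.Fin.Properties as FinP
open import Data.Product using (Σ; _×_; _,_; ∃)
open import Data.Bool using (if_then_else_)
open import Relation.Nullary using (does)
open import Relation.Binary.PropositionalEquality using (_≡_)

data Item : Set where
  small large : Item

Lsz : ℕ → ℕ
Lsz S = 2 * S ∸ 1

Msz : ℕ → ℕ
Msz S = 4 * S ∸ 3

size : ℕ → Item → ℕ
size S small = S
size S large = Lsz S

Σ[_] : (m : ℕ) → (Fin m → ℕ) → ℕ
Σ[ zero ] g = 0
Σ[ suc m ] g = g zero + Σ[ m ] (λ j → g (suc j))

Packing : ℕ → ℕ → Set
Packing n m = Fin n → Fin m

module _ (S : ℕ) {n m : ℕ} (item : Fin n → Item) (bin : Fin m → ℕ) where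

  load : Packing n m → Fin m → ℕ
  load f j = Σ[ n ] (λ i → if does (f i FinP.≟ j) then size S (item i) else 0)

  Later : Packing n m → Fin m → Fin n → Set
  Later f j i = Data.Fin._<_ j (f i)

  IsPacking : Packing n m → Set
  IsPacking f = ∀ j → load f j ≤ bin j

  Empty : Packing n m → Fin m → Set
  Empty f j = ∀ i → (f i ≡ j → Data.Empty.⊥)

  Valid : Packing n m → Set
  Valid f = IsPacking f ×
            (∀ j → Empty f j → ∀ i → Later f j i → bin j < size S (item i))

  cost : Packing n m → ℕ
  cost f = Σ[ m ] (λ j → if does (any? (λ i → f i FinP.≟ j)) then bin j else 0)

  Optimal : Packing n m → Set
  Optimal f = Valid f × (∀ g → Valid g → cost f ≤ cost g)

  space : Packing n m → Fin m → ℕ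
  space f j = bin j ∸ load f j

  Wasteful : Packing n m → Fin m → Set
  Wasteful f j = ∃ λ i → Later f j i × size S (item i) ≤ space f j

  Thrifty : Packing n m → Set
  Thrifty f = ∀ j → Wasteful f j → Data.Empty.⊥

  Bad : Packing n m → Fin m → Set
  Bad f j = (∃ λ i → f i ≡ j × item i ≡ small)
          × (Lsz S ∸ S ≤ space f j)
          × (∃ λ i → Later f j i × item i ≡ large)

-- Fix a valid packing f of minimum cost which, among those, minimises the potential
-- Φ f = Σᵢ size(i) · (position of the bin of i); moving an item to an earlier bin lowers Φ.
-- If a bin of f were wasteful, moving the later item into it would lower Φ; the holes this may leave
-- are refilled by a Φ-minimal packing that uses only bins of f and moves items only leftwards, which
-- is valid and no dearer than f.
-- If bin j were bad, holding a small item s while a large item ℓ lies further right, then either no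
-- empty bin lies between them and exchanging s and ℓ keeps the packing valid at no extra cost and lowers Φ, or
-- the first empty bin j′ after j is followed by large items only, one per bin since two exceed M; then
-- moving the large item of the last used bin into j and s into j′ empties a bin larger than j′ and
-- lowers the cost.

module Submission where

import Defs as D
open D using (Item; small; large; size; Lsz; Msz; Σ[_]; Packing)
open import Data.Nat using (ℕ; zero; suc; _+_; _*_; _∸_; _≤_; _<_; z≤n; s≤s; z<s; _<?_; _≤?_; NonZero; >-nonZero)
open import Data.Nat.Properties
open import Data.Nat.Induction using (<-wellFounded)
open import Data.Fin using (Fin; zero; suc; toℕ; finToFun; funToFin)
import Data.Fin.Properties as Fin
open import Data.Vec.Functional using (updateAt)
open import Data.Vec.Functional.Properties using (updateAt-updates; updateAt-minimal)
open import Data.Product using (_×_; _,_; ∃; proj₁; proj₂)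
open import Data.Sum using (_⊎_; inj₁; inj₂; [_,_]′)
open import Data.Bool using (if_then_else_)
open import Data.Empty using (⊥; ⊥-elim)
open import Function using (_∘_; const; id)
open import Data.List using (allFin)
import Data.List.Relation.Unary.All as All
open import Data.List.Membership.Propositional.Properties using (∈-allFin)
open import Data.List.Extrema.Nat using (argmax; f[xs]≤f[argmax])
open import Induction.WellFounded using (Acc; acc)
open import Relation.Nullary using (Dec; yes; no; does; ¬_)
open import Relation.Nullary.Decidable using (map′; _×-dec_; _→-dec_; ¬?; dec-true; dec-false)
open import Relation.Unary using (Decidable)
open import Relation.Binary.PropositionalEquality
open import Relation.Binary.Definitions using (tri<; tri≈; tri>)
open import Data.Nat.Tactic.RingSolver using (solve-∀)

Σ-cong : ∀ {n} {g h : Fin n → ℕ} → g ≗ h → Σ[ n ] g ≡ Σ[ n ] h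
Σ-cong {zero}  g≗h = refl
Σ-cong {suc n} g≗h = cong₂ _+_ (g≗h zero) (Σ-cong (g≗h ∘ suc))

Σ-mono : ∀ {n} {g h : Fin n → ℕ} → (∀ i → g i ≤ h i) → Σ[ n ] g ≤ Σ[ n ] h
Σ-mono {zero}  g≤h = z≤n
Σ-mono {suc n} g≤h = +-mono-≤ (g≤h zero) (Σ-mono (g≤h ∘ suc))

Σ-+ : ∀ {n} (g h : Fin n → ℕ) → Σ[ n ] (λ i → g i + h i) ≡ Σ[ n ] g + Σ[ n ] h
Σ-+ {zero}  g h = refl
Σ-+ {suc n} g h = begin
  g zero + h zero + Σ[ n ] (λ i → g (suc i) + h (suc i))
    ≡⟨ cong (g zero + h zero +_) (Σ-+ (g ∘ suc) (h ∘ suc)) ⟩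
  g zero + h zero + (Σ[ n ] (g ∘ suc) + Σ[ n ] (h ∘ suc))
    ≡⟨ interchange (g zero) (h zero) _ _ ⟩
  g zero + Σ[ n ] (g ∘ suc) + (h zero + Σ[ n ] (h ∘ suc)) ∎
  where
  open ≡-Reasoning
  interchange : ∀ a b c d → a + b + (c + d) ≡ a + c + (b + d)
  interchange = solve-∀

Σ-zero : ∀ n → Σ[ n ] (const 0) ≡ 0
Σ-zero zero    = refl
Σ-zero (suc n) = Σ-zero n

Σ-update : ∀ {n} (g h : Fin n → ℕ) (k : Fin n) → (∀ i → i ≢ k → g i ≡ h i) →
           Σ[ n ] g + h k ≡ Σ[ n ] h + g k
Σ-update {suc n} g h zero g≡h = begin
  g zero + Σ[ n ] (g ∘ suc) + h zero ≡⟨ cong (λ t → g zero + t + h zero)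
                                          (Σ-cong (λ i → g≡h (suc i) λ ())) ⟩
  g zero + Σ[ n ] (h ∘ suc) + h zero ≡⟨ rotate (g zero) _ _ ⟩
  h zero + Σ[ n ] (h ∘ suc) + g zero ∎
  where
  open ≡-Reasoning
  rotate : ∀ a b c → a + b + c ≡ c + b + a
  rotate = solve-∀
Σ-update {suc n} g h (suc k) g≡h = begin
  g zero + Σ[ n ] (g ∘ suc) + h (suc k)   ≡⟨ +-assoc (g zero) _ _ ⟩
  g zero + (Σ[ n ] (g ∘ suc) + h (suc k)) ≡⟨ cong₂ _+_ (g≡h zero λ ())
                                               (Σ-update (g ∘ suc) (h ∘ suc) k
                                                 λ i i≢k → g≡h (suc i) (i≢k ∘ Fin.suc-injective)) ⟩
  h zero + (Σ[ n ] (h ∘ suc) + g (suc k)) ≡⟨ +-assoc (h zero) _ _ ⟨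
  h zero + Σ[ n ] (h ∘ suc) + g (suc k)   ∎
  where open ≡-Reasoning

Σ-single : ∀ {n} (k : Fin n) (v : ℕ) → Σ[ n ] (λ i → if does (k Fin.≟ i) then v else 0) ≡ v
Σ-single {n} k v = +-cancelʳ-≡ 0 _ _ (begin
  Σ[ n ] single + 0             ≡⟨ Σ-update single (const 0) k single-elsewhere ⟩
  Σ[ n ] (const 0) + single k   ≡⟨ cong₂ _+_ (Σ-zero n)
                                             (cong (if_then v else 0) (dec-true (k Fin.≟ k) refl)) ⟩
  v                             ≡⟨ +-identityʳ v ⟨
  v + 0                         ∎)
  where
  open ≡-Reasoning
  single : Fin n → ℕ
  single i = if does (k Fin.≟ i) then v else 0
  single-elsewhere : ∀ i → i ≢ k → single i ≡ 0
  single-elsewhere i i≢k = cong (if_then v else 0) (dec-false (k Fin.≟ i) (≢-sym i≢k))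

Σ-term-≤ : ∀ {n} (g : Fin n → ℕ) (i : Fin n) → g i ≤ Σ[ n ] g
Σ-term-≤ g zero    = m≤m+n _ _
Σ-term-≤ g (suc i) = ≤-trans (Σ-term-≤ (g ∘ suc) i) (m≤n+m _ _)

Σ-terms-≤ : ∀ {n} (g : Fin n → ℕ) {i k : Fin n} → i ≢ k → g i + g k ≤ Σ[ n ] g
Σ-terms-≤ g {zero}  {zero}  0≢0 = ⊥-elim (0≢0 refl)
Σ-terms-≤ g {zero}  {suc k} _ = +-monoʳ-≤ (g zero) (Σ-term-≤ (g ∘ suc) k)
Σ-terms-≤ g {suc i} {zero}  _ =
  subst (_≤ Σ[ _ ] g) (+-comm (g zero) _) (+-monoʳ-≤ (g zero) (Σ-term-≤ (g ∘ suc) i))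
Σ-terms-≤ g {suc i} {suc k} i≢k = ≤-trans (Σ-terms-≤ (g ∘ suc) (i≢k ∘ cong suc)) (m≤n+m _ _)

move : ∀ {n m} → (Fin n → Fin m) → Fin n → Fin m → Fin n → Fin m
move f i t = updateAt f i (const t)

move-moved : ∀ {n m} (f : Fin n → Fin m) i t → move f i t i ≡ t
move-moved f i t = updateAt-updates i f

move-unmoved : ∀ {n m} (f : Fin n → Fin m) i t {k} → k ≢ i → move f i t k ≡ f k
move-unmoved f i t {k} k≢i = updateAt-minimal k i f k≢i

weight : ∀ {n m} → (Fin n → Fin m → ℕ) → (Fin n → Fin m) → ℕ
weight {n} w f = Σ[ n ] (λ k → w k (f k))

weight-cong : ∀ {n m} (w : Fin n → Fin m → ℕ) {f g : Fin n → Fin m} → f ≗ g →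
              weight w f ≡ weight w g
weight-cong w f≗g = Σ-cong (λ k → cong (w k) (f≗g k))

weight-move : ∀ {n m} (w : Fin n → Fin m → ℕ) f i t →
              weight w (move f i t) + w i (f i) ≡ weight w f + w i t
weight-move w f i t = begin
  weight w (move f i t) + w i (f i) ≡⟨ Σ-update _ _ i (λ k k≢i → cong (w k) (move-unmoved f i t k≢i)) ⟩
  weight w f + w i (move f i t i)   ≡⟨ cong (λ y → weight w f + w i y) (move-moved f i t) ⟩
  weight w f + w i t                ∎
  where open ≡-Reasoning

weight-move₂ : ∀ {n m} (w : Fin n → Fin m → ℕ) f {a b} ta tb → a ≢ b →
               weight w (move (move f a ta) b tb) + (w a (f a) + w b (f b)) ≡
               weight w f + (w a ta + w b tb)
weight-move₂ {n} {m} w f {a} {b} ta tb a≢b = begin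
  weight w h + (w a (f a) + w b (f b))     ≡⟨ shuffle (weight w h) _ _ ⟩
  weight w h + w b (f b) + w a (f a)       ≡⟨ cong (λ y → weight w h + w b y + w a (f a))
                                                    (move-unmoved f a ta (a≢b ∘ sym)) ⟨
  weight w h + w b (g b) + w a (f a)       ≡⟨ cong (_+ w a (f a)) (weight-move w g b tb) ⟩
  weight w g + w b tb + w a (f a)          ≡⟨ shuffle′ (weight w g) _ _ ⟩
  weight w g + w a (f a) + w b tb          ≡⟨ cong (_+ w b tb) (weight-move w f a ta) ⟩
  weight w f + w a ta + w b tb             ≡⟨ +-assoc (weight w f) _ _ ⟩
  weight w f + (w a ta + w b tb)           ∎
  where
  open ≡-Reasoning
  g h : Fin n → Fin m
  g = move f a ta
  h = move g b tb
  shuffle : ∀ x y z → x + (y + z) ≡ x + z + y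
  shuffle = solve-∀
  shuffle′ : ∀ x y z → x + y + z ≡ x + z + y
  shuffle′ = solve-∀

module _ {a p} {A : Set a} {P : A → Set p} (μ : A → ℕ)
         (below? : ∀ c → Dec (∃ λ x → P x × μ x < c)) where

  ∃-minimal : ∀ {x} → P x → ∃ λ x* → P x* × (∀ {y} → P y → μ x* ≤ μ y)
  ∃-minimal {x} px = descend x px (<-wellFounded (μ x))
    where
    descend : ∀ x → P x → Acc _<_ (μ x) → ∃ λ x* → P x* × (∀ {y} → P y → μ x* ≤ μ y)
    descend x px (acc smaller) with below? (μ x)
    ... | yes (y , py , y<x) = descend y py (smaller y<x)
    ... | no nothing-below = x , px , λ py → ≮⇒≥ (λ y<x → nothing-below (_ , py , y<x))

∃-function? : ∀ {n m p} {P : (Fin n → Fin m) → Set p} →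
              (∀ {f g} → f ≗ g → P f → P g) → Decidable P → Dec (∃ P)
∃-function? resp P? =
  map′ (λ { (k , pk) → finToFun k , pk })
       (λ { (f , pf) → funToFin f , resp (sym ∘ Fin.finToFun-funToFin f) pf })
       (Fin.any? (P? ∘ finToFun))

∃-minimal-function : ∀ {n m p} {P : (Fin n → Fin m) → Set p} →
                     (∀ {f g} → f ≗ g → P f → P g) → Decidable P →
                     (μ : (Fin n → Fin m) → ℕ) → (∀ {f g} → f ≗ g → μ f ≡ μ g) →
                     ∀ {f} → P f → ∃ λ f* → P f* × (∀ {g} → P g → μ f* ≤ μ g)
∃-minimal-function {P = P} resp P? μ μ-cong = ∃-minimal μ below?
  where
  below? : ∀ c → Dec (∃ λ f → P f × μ f < c)
  below? c = ∃-function? (λ f≗g (pf , μf<c) → resp f≗g pf , subst (_< c) (μ-cong f≗g) μf<c)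
                         (λ f → P? f ×-dec μ f <? c)

L≡S+[S∸1] : ∀ S → Lsz S ≡ S + (S ∸ 1)
L≡S+[S∸1] zero    = refl
L≡S+[S∸1] (suc s) = double s
  where
  double : ∀ s → s + suc (s + 0) ≡ suc (s + s)
  double = solve-∀

S≤L : ∀ S → S ≤ Lsz S
S≤L S = subst (S ≤_) (sym (L≡S+[S∸1] S)) (m≤m+n S _)

S<L : ∀ {S} → 1 < S → S < Lsz S
S<L {S} 1<S = subst (S <_) (sym (L≡S+[S∸1] S)) (m<m+n S (m<n⇒0<n∸m 1<S))

M<L+L : ∀ {S} → 1 < S → Msz S < Lsz S + Lsz S
M<L+L {suc zero} (s≤s ())
M<L+L {suc (suc s)} _ =
  subst₂ (λ M L → M < L + L) (sym (cong (_∸ 3) (quadruple s))) (sym (cong (_∸ 1) (double s)))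
         (≤-reflexive (sym (sum s)))
  where
  quadruple : ∀ s → 4 * (2 + s) ≡ 8 + 4 * s
  quadruple = solve-∀
  double : ∀ s → 2 * (2 + s) ≡ 4 + 2 * s
  double = solve-∀
  sum : ∀ s → (3 + 2 * s) + (3 + 2 * s) ≡ 6 + 4 * s
  sum = solve-∀

rearrangement : ∀ {a b j k} → a < b → j < k → a * k + b * j < a * j + b * k
rearrangement {a} {j = j} a<b j<k with m≤n⇒∃[o]m+o≡n a<b | m≤n⇒∃[o]m+o≡n j<k
... | d , refl | e , refl =
  subst (a * (suc j + e) + (suc a + d) * j <_) (gain a d j e)
        (m<m+n (a * (suc j + e) + (suc a + d) * j) z<s)
  where
  gain : ∀ a d j e → a * (suc j + e) + (suc a + d) * j + suc d * suc e ≡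
                     a * j + (suc a + d) * (suc j + e)
  gain = solve-∀

fits-after-exchange : ∀ {a l b s L} → s ≤ L → l ≤ b → L ∸ s ≤ b ∸ l → a + s ≡ l + L → a ≤ b
fits-after-exchange {a} {l} {b} {s} {L} s≤L l≤b room eq = +-cancelʳ-≤ s a b (begin
  a + s               ≡⟨ eq ⟩
  l + L               ≡⟨ cong (l +_) (m∸n+n≡m s≤L) ⟨
  l + (L ∸ s + s)     ≡⟨ +-assoc l _ s ⟨
  l + (L ∸ s) + s     ≤⟨ +-monoˡ-≤ s (+-monoʳ-≤ l room) ⟩
  l + (b ∸ l) + s     ≡⟨ cong (_+ s) (m+[n∸m]≡n l≤b) ⟩
  b + s               ∎)
  where open ≤-Reasoning

cancel-< : ∀ {a b x y} → a + x ≡ b + y → y < x → a < b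
cancel-< {a} {b} {x} {y} eq y<x = +-cancelʳ-< x a b (begin-strict
  a + x ≡⟨ eq ⟩
  b + y <⟨ +-monoʳ-< b y<x ⟩
  b + x ∎)
  where open ≤-Reasoning

module Packings (S : ℕ) {n m : ℕ} (item : Fin n → Item) (bin : Fin m → ℕ) where

  sz : Fin n → ℕ
  sz i = size S (item i)

  load : Packing n m → Fin m → ℕ
  load = D.load S item bin

  space : Packing n m → Fin m → ℕ
  space = D.space S item bin

  Empty : Packing n m → Fin m → Set
  Empty = D.Empty S item bin

  Later : Packing n m → Fin m → Fin n → Set
  Later = D.Later S item bin

  IsPacking : Packing n m → Set
  IsPacking = D.IsPacking S item bin

  Valid : Packing n m → Set
  Valid = D.Valid S item bin

  cost : Packing n m → ℕ
  cost = D.cost S item bin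

  Optimal : Packing n m → Set
  Optimal = D.Optimal S item bin

  Thrifty : Packing n m → Set
  Thrifty = D.Thrifty S item bin

  Bad : Packing n m → Fin m → Set
  Bad = D.Bad S item bin

  Used : Packing n m → Fin m → Set
  Used f x = ∃ λ i → f i ≡ x

  Compact : Packing n m → Set
  Compact f = ∀ x → Empty f x → ∀ i → Later f x i → bin x < sz i

  sz-small : ∀ {i} → item i ≡ small → sz i ≡ S
  sz-small {i} small-i = cong (size S) small-i

  sz-large : ∀ {i} → item i ≡ large → sz i ≡ Lsz S
  sz-large {i} large-i = cong (size S) large-i

  S≤sz : ∀ i → S ≤ sz i
  S≤sz i with item i
  ... | small = ≤-refl
  ... | large = S≤L S

  large-if-exceeds : ∀ {b i} → S ≤ b → b < sz i → item i ≡ large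
  large-if-exceeds {i = i} S≤b b<sz with item i
  ... | small = ⊥-elim (<⇒≱ b<sz S≤b)
  ... | large = refl

  Used? : ∀ f x → Dec (Used f x)
  Used? f x = Fin.any? (λ i → f i Fin.≟ x)

  Empty? : ∀ f x → Dec (Empty f x)
  Empty? f x = Fin.all? (λ i → ¬? (f i Fin.≟ x))

  empty-if-unused : ∀ {f x} → ¬ Used f x → Empty f x
  empty-if-unused unused i fi≡x = unused (i , fi≡x)

  -- Contribution of item i, placed in bin y, to the load of bin x; load f x is weight (put x) f.
  put : Fin m → Fin n → Fin m → ℕ
  put x i y = if does (y Fin.≟ x) then sz i else 0

  put-here : ∀ x i → put x i x ≡ sz i
  put-here x i = cong (if_then sz i else 0) (dec-true (x Fin.≟ x) refl)

  put-elsewhere : ∀ {x y} i → y ≢ x → put x i y ≡ 0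
  put-elsewhere {x} {y} i y≢x = cong (if_then sz i else 0) (dec-false (y Fin.≟ x) y≢x)

  load-move : ∀ f i t x → load (move f i t) x + put x i (f i) ≡ load f x + put x i t
  load-move f i t x = weight-move (put x) f i t

  load-move-≤ : ∀ f i t x → load (move f i t) x ≤ load f x + put x i t
  load-move-≤ f i t x = ≤-trans (m≤m+n _ _) (≤-reflexive (load-move f i t x))

  load-≥-member : ∀ f i → sz i ≤ load f (f i)
  load-≥-member f i = subst (_≤ load f (f i)) (put-here (f i) i) (Σ-term-≤ (λ k → put (f i) k (f k)) i)

  load-≥-members : ∀ f {i k x} → i ≢ k → f i ≡ x → f k ≡ x → sz i + sz k ≤ load f x
  load-≥-members f {i} {k} {x} i≢k refl fk≡x =
    subst (_≤ load f (f i))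
          (cong₂ _+_ (put-here (f i) i) (trans (cong (put (f i) k) fk≡x) (put-here (f i) k)))
          (Σ-terms-≤ (λ k′ → put (f i) k′ (f k′)) i≢k)

  load-empty : ∀ f {x} → Empty f x → load f x ≡ 0
  load-empty f empty = trans (Σ-cong (λ i → put-elsewhere i (empty i))) (Σ-zero n)

  space-empty : ∀ f {x} → Empty f x → space f x ≡ bin x
  space-empty f {x} empty = cong (bin x ∸_) (load-empty f empty)

  move-fits : ∀ {f} i t → IsPacking f → sz i ≤ space f t → IsPacking (move f i t)
  move-fits {f} i t packs fits x with t Fin.≟ x
  ... | yes refl = begin
    load (move f i t) t      ≤⟨ load-move-≤ f i t t ⟩
    load f t + put t i t     ≡⟨ cong (load f t +_) (put-here t i) ⟩
    load f t + sz i          ≤⟨ +-monoʳ-≤ (load f t) fits ⟩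
    load f t + space f t     ≡⟨ m+[n∸m]≡n (packs t) ⟩
    bin t                    ∎
    where open ≤-Reasoning
  ... | no t≢x = begin
    load (move f i t) x      ≤⟨ load-move-≤ f i t x ⟩
    load f x + put x i t     ≡⟨ cong (load f x +_) (put-elsewhere i t≢x) ⟩
    load f x + 0             ≡⟨ +-identityʳ _ ⟩
    load f x                 ≤⟨ packs x ⟩
    bin x                    ∎
    where open ≤-Reasoning

  move-used : ∀ f i t {x} → Used (move f i t) x → Used f x ⊎ x ≡ t
  move-used f i t (k , gk≡x) with k Fin.≟ i
  ... | yes refl = inj₂ (trans (sym gk≡x) (move-moved f i t))
  ... | no k≢i = inj₁ (k , trans (sym (move-unmoved f i t k≢i)) gk≡x)

  moment : Fin n → Fin m → ℕ
  moment i y = sz i * toℕ y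

  Φ : Packing n m → ℕ
  Φ = weight moment

  Φ-move-< : 0 < S → ∀ f {i t} → Later f t i → Φ (move f i t) < Φ f
  Φ-move-< 0<S f {i} {t} t<fi = +-cancelʳ-< (sz i * toℕ (f i)) _ _ (begin-strict
    Φ (move f i t) + sz i * toℕ (f i) ≡⟨ weight-move moment f i t ⟩
    Φ f + sz i * toℕ t                <⟨ +-monoʳ-< (Φ f) (*-monoʳ-< (sz i) {{sz≢0}} t<fi) ⟩
    Φ f + sz i * toℕ (f i)            ∎)
    where
    open ≤-Reasoning
    sz≢0 : NonZero (sz i)
    sz≢0 = >-nonZero (≤-trans 0<S (S≤sz i))

  -- cost f is Σ[ m ] (charge f) by definition.
  charge : Packing n m → Fin m → ℕ
  charge f x = if does (Used? f x) then bin x else 0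

  charge-used : ∀ f {x} → Used f x → charge f x ≡ bin x
  charge-used f {x} used = cong (if_then bin x else 0) (dec-true (Used? f x) used)

  charge-empty : ∀ f {x} → Empty f x → charge f x ≡ 0
  charge-empty f {x} empty = cong (if_then bin x else 0) (dec-false (Used? f x) λ (i , fi≡x) → empty i fi≡x)

  charge-cases : ∀ f x → (Used f x × charge f x ≡ bin x) ⊎ charge f x ≡ 0
  charge-cases f x with Used? f x
  ... | yes used = inj₁ (used , refl)
  ... | no _ = inj₂ refl

  cost-mono : ∀ {f g} → (∀ {x} → Used g x → Used f x) → cost g ≤ cost f
  cost-mono {f} {g} used⊆ = Σ-mono charge-≤
    where
    charge-≤ : ∀ x → charge g x ≤ charge f x
    charge-≤ x with charge-cases g x
    ... | inj₁ (used , charge≡bin) = ≤-reflexive (trans charge≡bin (sym (charge-used f (used⊆ used))))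
    ... | inj₂ charge≡0 = subst (_≤ charge f x) (sym charge≡0) z≤n

  cost-exchange : ∀ {f g a b} → Used f a → Empty g a → (∀ {x} → Used g x → Used f x ⊎ x ≡ b) →
                  cost g + bin a ≤ cost f + bin b
  cost-exchange {f} {g} {a} {b} used-a empty-a used⊆ = begin
    cost g + bin a                        ≡⟨ cong (cost g +_) (Σ-single a (bin a)) ⟨
    cost g + Σ[ m ] (at a)                ≡⟨ Σ-+ (charge g) (at a) ⟨
    Σ[ m ] (λ x → charge g x + at a x)    ≤⟨ Σ-mono pointwise ⟩
    Σ[ m ] (λ x → charge f x + at b x)    ≡⟨ Σ-+ (charge f) (at b) ⟩
    cost f + Σ[ m ] (at b)                ≡⟨ cong (cost f +_) (Σ-single b (bin b)) ⟩
    cost f + bin b                        ∎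
    where
    open ≤-Reasoning
    at : Fin m → Fin m → ℕ
    at y x = if does (y Fin.≟ x) then bin y else 0
    at-here : ∀ y → at y y ≡ bin y
    at-here y = cong (if_then bin y else 0) (dec-true (y Fin.≟ y) refl)
    charge-g : ∀ x → charge g x ≤ charge f x + at b x
    charge-g x with charge-cases g x
    ... | inj₂ charge≡0 = subst (_≤ charge f x + at b x) (sym charge≡0) z≤n
    ... | inj₁ (used , charge≡bin) with used⊆ used
    ...   | inj₁ used-f = ≤-trans (≤-reflexive (trans charge≡bin (sym (charge-used f used-f)))) (m≤m+n _ _)
    ...   | inj₂ refl = ≤-trans (≤-reflexive (trans charge≡bin (sym (at-here b)))) (m≤n+m _ _)
    pointwise : ∀ x → charge g x + at a x ≤ charge f x + at b x
    pointwise x with a Fin.≟ x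
    ... | yes refl = ≤-trans (≤-reflexive (trans (cong (_+ bin a) (charge-empty g empty-a))
                                                (sym (charge-used f used-a))))
                            (m≤m+n _ _)
    ... | no _ = subst (_≤ charge f x + at b x) (sym (+-identityʳ _)) (charge-g x)

  used-cong : ∀ {f g} → f ≗ g → ∀ {x} → Used f x → Used g x
  used-cong f≗g (i , fi≡x) = i , trans (sym (f≗g i)) fi≡x

  empty-cong : ∀ {f g} → f ≗ g → ∀ {x} → Empty f x → Empty g x
  empty-cong f≗g empty i gi≡x = empty i (trans (f≗g i) gi≡x)

  load-cong : ∀ {f g} → f ≗ g → ∀ x → load f x ≡ load g x
  load-cong f≗g x = weight-cong (put x) f≗g

  Φ-cong : ∀ {f g} → f ≗ g → Φ f ≡ Φ g
  Φ-cong = weight-cong moment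

  cost-cong : ∀ {f g} → f ≗ g → cost f ≡ cost g
  cost-cong {f} {g} f≗g = Σ-cong charge-cong
    where
    charge-cong : ∀ x → charge f x ≡ charge g x
    charge-cong x with Used? f x
    ... | yes used = sym (charge-used g (used-cong f≗g used))
    ... | no unused = sym (charge-empty g (empty-cong f≗g (empty-if-unused unused)))

  IsPacking-cong : ∀ {f g} → f ≗ g → IsPacking f → IsPacking g
  IsPacking-cong f≗g packs x = subst (_≤ bin x) (load-cong f≗g x) (packs x)

  Valid-cong : ∀ {f g} → f ≗ g → Valid f → Valid g
  Valid-cong f≗g (packs , compact) =
    IsPacking-cong f≗g packs ,
    λ x empty i later → compact x (empty-cong (sym ∘ f≗g) empty) i
                          (subst (λ y → toℕ x < toℕ y) (sym (f≗g i)) later)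

  IsPacking? : ∀ f → Dec (IsPacking f)
  IsPacking? f = Fin.all? (λ x → load f x ≤? bin x)

  Valid? : ∀ f → Dec (Valid f)
  Valid? f = IsPacking? f ×-dec
             Fin.all? (λ x → Empty? f x →-dec Fin.all? (λ i → (x Fin.<? f i) →-dec (bin x <? sz i)))

  Φ-minimal-compact : 0 < S → {C : Packing n m → Set} →
                      (∀ {g x i} → C g → Empty g x → Later g x i → sz i ≤ bin x → C (move g i x)) →
                      ∀ {f} → C f → (∀ {g} → C g → Φ f ≤ Φ g) → Compact f
  Φ-minimal-compact 0<S closed {f} Cf Φ-least x empty i later =
    ≰⇒> λ fits → <⇒≱ (Φ-move-< 0<S f later) (Φ-least (closed Cf empty later fits))

  valid-exists : 0 < S → ∀ {f} → IsPacking f → ∃ Valid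
  valid-exists 0<S {f₀} packs₀ =
    let f , packs , Φ-least =
          ∃-minimal-function {P = IsPacking} IsPacking-cong IsPacking? Φ Φ-cong {f₀} packs₀
    in f , packs , Φ-minimal-compact 0<S fill packs Φ-least
    where
    fill : ∀ {g x i} → IsPacking g → Empty g x → Later g x i → sz i ≤ bin x → IsPacking (move g i x)
    fill {g} {x} {i} packs empty _ fits =
      move-fits i x packs (subst (sz i ≤_) (sym (space-empty g empty)) fits)

  ΦOptimal : Packing n m → Set
  ΦOptimal f = Optimal f × (∀ {g} → Valid g → cost g ≤ cost f → Φ f ≤ Φ g)

  Φ-optimal-exists : ∀ {f} → Valid f → ∃ ΦOptimal
  Φ-optimal-exists {f₀} valid₀ =
    let f₁ , valid₁ , cheapest =
          ∃-minimal-function {P = Valid} Valid-cong Valid? cost cost-cong {f₀} valid₀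
        f , (valid , f≤f₁) , Φ-least =
          ∃-minimal-function {P = λ g → Valid g × cost g ≤ cost f₁}
            (λ f≗g (valid , bound) → Valid-cong f≗g valid , subst (_≤ cost f₁) (cost-cong f≗g) bound)
            (λ g → Valid? g ×-dec cost g ≤? cost f₁) Φ Φ-cong {f₁} (valid₁ , ≤-refl)
    in f , (valid , λ g valid-g → ≤-trans f≤f₁ (cheapest valid-g)) ,
       λ valid-g g≤f → Φ-least (valid-g , ≤-trans g≤f f≤f₁)

  used-if-fits : ∀ {f : Packing n m} {x i} → Compact f → Later f x i → sz i ≤ bin x → Used f x
  used-if-fits {f} {x} compact later fits with Used? f x
  ... | yes used = used
  ... | no unused = ⊥-elim (<⇒≱ (compact x (empty-if-unused unused) _ later) fits)

  Below : Packing n m → Packing n m → Set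
  Below f g = IsPacking g × (∀ x → Used g x → Used f x) × (∀ k → toℕ (g k) ≤ toℕ (f k))

  module _ {f : Packing n m} where

    Below-cong : ∀ {g g′} → g ≗ g′ → Below f g → Below f g′
    Below-cong g≗g′ (g-packs , g-used , g≤f) =
      IsPacking-cong g≗g′ g-packs , (λ x → g-used x ∘ used-cong (sym ∘ g≗g′)) ,
      λ k → subst (λ y → toℕ y ≤ toℕ (f k)) (g≗g′ k) (g≤f k)

    Below? : ∀ g → Dec (Below f g)
    Below? g = IsPacking? g ×-dec Fin.all? (λ x → Used? g x →-dec Used? f x) ×-dec
               Fin.all? (λ k → toℕ (g k) ≤? toℕ (f k))

    move-left : ∀ {g : Packing n m} {k x} → toℕ x < toℕ (g k) → (∀ k → toℕ (g k) ≤ toℕ (f k)) →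
                ∀ k′ → toℕ (move g k x k′) ≤ toℕ (f k′)
    move-left {g} {k} {x} x<gk g≤f k′ with k′ Fin.≟ k
    ... | yes refl = ≤-trans (≤-reflexive (cong toℕ (move-moved g k x))) (<⇒≤ (<-≤-trans x<gk (g≤f k)))
    ... | no k′≢k = ≤-trans (≤-reflexive (cong toℕ (move-unmoved g k x k′≢k))) (g≤f k′)

    -- The bins f leaves empty are covered by f's own compactness.
    Below-closed : Compact f → ∀ {g : Packing n m} {x k} → Below f g →
                   Empty g x → Later g x k → sz k ≤ bin x → Below f (move g k x)
    Below-closed compact {g} {x} {k} (g-packs , g-used , g≤f) empty later fits =
      move-fits k x g-packs (subst (sz k ≤_) (sym (space-empty g empty)) fits) ,
      (λ y used → [ g-used y , (λ { refl → used-if-fits compact (<-≤-trans later (g≤f k)) fits }) ]′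
                    (move-used g k x used)) ,
      move-left later g≤f

    Below-move : IsPacking f → Compact f → ∀ {i j} → Later f j i → sz i ≤ space f j →
                 Below f (move f i j)
    Below-move packs compact {i} {j} later fits =
      move-fits i j packs fits ,
      (λ x used → [ id , (λ { refl → used-if-fits compact later (≤-trans fits (m∸n≤m _ (load f j))) }) ]′
                    (move-used f i j used)) ,
      move-left later (λ _ → ≤-refl)

  thrifty : 0 < S → ∀ {f} → ΦOptimal f → Thrifty f
  thrifty 0<S {f} (((packs , compact) , _) , Φ-least) j (i , later , fits) =
    let below-f : Below f (move f i j)
        below-f = Below-move packs compact later fits
        h , below-h , Φ-least-h = ∃-minimal-function Below-cong Below? Φ Φ-cong {move f i j} below-f
        h-packs , h-used , _ = below-h
    in <⇒≱ (≤-<-trans (Φ-least-h below-f) (Φ-move-< 0<S f later))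
           (Φ-least (h-packs , Φ-minimal-compact 0<S (Below-closed compact) below-h Φ-least-h)
                    (cost-mono (h-used _)))

  module Exchange {f : Packing n m} (valid : Valid f) {s ℓ : Fin n} {t : Fin m}
                  (s-small : item s ≡ small) (room : Lsz S ∸ S ≤ space f (f s))
                  (ℓ-large : item ℓ ≡ large)
                  (s<ℓ : toℕ (f s) < toℕ (f ℓ)) (s<t : toℕ (f s) < toℕ t) where

    g : Packing n m
    g = move (move f s t) ℓ (f s)

    s≢ℓ : s ≢ ℓ
    s≢ℓ s≡ℓ with () ← trans (sym s-small) (trans (cong item s≡ℓ) ℓ-large)

    g-s : g s ≡ t
    g-s = trans (move-unmoved _ ℓ (f s) s≢ℓ) (move-moved f s t)

    g-ℓ : g ℓ ≡ f s
    g-ℓ = move-moved _ ℓ (f s)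

    g-other : ∀ {k} → k ≢ s → k ≢ ℓ → g k ≡ f k
    g-other k≢s k≢ℓ = trans (move-unmoved _ ℓ (f s) k≢ℓ) (move-unmoved f s t k≢s)

    load-g : ∀ x → load g x + (put x s (f s) + put x ℓ (f ℓ)) ≡ load f x + (put x s t + put x ℓ (f s))
    load-g x = weight-move₂ (put x) f t (f s) s≢ℓ

    load-g-≤ : ∀ x → load g x ≤ load f x + (put x s t + put x ℓ (f s))
    load-g-≤ x = ≤-trans (m≤m+n _ _) (≤-reflexive (load-g x))

    fits-at-s : load g (f s) ≤ bin (f s)
    fits-at-s = fits-after-exchange (S≤L S) (proj₁ valid (f s)) room (begin
      load g (f s) + S                 ≡⟨ cong (λ y → load g (f s) + y) (sym (+-identityʳ S)) ⟩
      load g (f s) + (S + 0)           ≡⟨ cong₂ (λ a b → load g (f s) + (a + b))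
                                             (sym (trans (put-here (f s) s) (sz-small s-small)))
                                             (sym (put-elsewhere ℓ (≢-sym (Fin.<⇒≢ s<ℓ)))) ⟩
      load g (f s) + (put (f s) s (f s) + put (f s) ℓ (f ℓ)) ≡⟨ load-g (f s) ⟩
      load f (f s) + (put (f s) s t + put (f s) ℓ (f s))    ≡⟨ cong₂ (λ a b → load f (f s) + (a + b))
                                             (put-elsewhere s (≢-sym (Fin.<⇒≢ s<t)))
                                             (trans (put-here (f s) ℓ) (sz-large ℓ-large)) ⟩
      load f (f s) + Lsz S             ∎)
      where open ≡-Reasoning

    is-packing : load g t ≤ bin t → IsPacking g
    is-packing fits-t x with x Fin.≟ f s | x Fin.≟ t
    ... | yes refl | _ = fits-at-s
    ... | no _ | yes refl = fits-t
    ... | no x≢s | no x≢t = begin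
      load g x                                  ≤⟨ load-g-≤ x ⟩
      load f x + (put x s t + put x ℓ (f s))    ≡⟨ cong₂ (λ a b → load f x + (a + b))
                                                     (put-elsewhere s (≢-sym x≢t))
                                                     (put-elsewhere ℓ (≢-sym x≢s)) ⟩
      load f x + 0                              ≡⟨ +-identityʳ _ ⟩
      load f x                                  ≤⟨ proj₁ valid x ⟩
      bin x                                     ∎
      where open ≤-Reasoning

    used-g : ∀ {x} → Used g x → Used f x ⊎ x ≡ t
    used-g used with move-used _ ℓ (f s) used
    ... | inj₁ used′ = move-used f s t used′
    ... | inj₂ refl = inj₁ (s , refl)

    compact-g : (∀ {x i} → Empty g x → Later g x i → x ≢ f ℓ) →
                (∀ {x} → Empty f x → toℕ (f s) < toℕ x → toℕ x < toℕ t → ⊥) → Compact g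
    compact-g not-fℓ no-gap x empty i later = proj₂ valid x empty-f i later-f
      where
      x≢fs : x ≢ f s
      x≢fs refl = empty ℓ g-ℓ
      empty-f : Empty f x
      empty-f k fk≡x with k Fin.≟ s | k Fin.≟ ℓ
      ... | yes refl | _ = x≢fs (sym fk≡x)
      ... | no _ | yes refl = not-fℓ empty later (sym fk≡x)
      ... | no k≢s | no k≢ℓ = empty k (trans (g-other k≢s k≢ℓ) fk≡x)
      before-s : toℕ x < toℕ t → toℕ x < toℕ (f s)
      before-s x<t with Fin.<-cmp x (f s)
      ... | tri< x<s _ _ = x<s
      ... | tri≈ _ x≡s _ = ⊥-elim (x≢fs x≡s)
      ... | tri> _ _ s<x = ⊥-elim (no-gap empty-f s<x x<t)
      later-f : Later f x i
      later-f with i Fin.≟ s | i Fin.≟ ℓ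
      ... | yes refl | _ = before-s (subst (λ y → toℕ x < toℕ y) g-s later)
      ... | no _ | yes refl = <-trans (subst (λ y → toℕ x < toℕ y) g-ℓ later) s<ℓ
      ... | no i≢s | no i≢ℓ = subst (λ y → toℕ x < toℕ y) (g-other i≢s i≢ℓ) later

  swap-with-later-large : 1 < S → ∀ {f} → ΦOptimal f →
                          ∀ {s ℓ} → item s ≡ small → Lsz S ∸ S ≤ space f (f s) →
                          item ℓ ≡ large → toℕ (f s) < toℕ (f ℓ) →
                          (∀ {x} → Empty f x → toℕ (f s) < toℕ x → toℕ x < toℕ (f ℓ) → ⊥) → ⊥
  swap-with-later-large 1<S {f} ((valid , _) , Φ-least) {s} {ℓ} s-small room ℓ-large s<ℓ no-gap =
    <⇒≱ Φ-g<Φ-f (Φ-least (is-packing fits-at-ℓ , compact-g not-at-ℓ no-gap) (cost-mono used⊆))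
    where
    open Exchange valid s-small room ℓ-large s<ℓ s<ℓ

    fits-at-ℓ : load g (f ℓ) ≤ bin (f ℓ)
    fits-at-ℓ = +-cancelʳ-≤ (Lsz S) _ _ (begin
      load g (f ℓ) + Lsz S        ≡⟨ cong₂ (λ a b → load g (f ℓ) + (a + b))
                                      (put-elsewhere s (Fin.<⇒≢ s<ℓ))
                                      (trans (put-here (f ℓ) ℓ) (sz-large ℓ-large)) ⟨
      load g (f ℓ) + (put (f ℓ) s (f s) + put (f ℓ) ℓ (f ℓ)) ≡⟨ load-g (f ℓ) ⟩
      load f (f ℓ) + (put (f ℓ) s (f ℓ) + put (f ℓ) ℓ (f s)) ≡⟨ cong₂ (λ a b → load f (f ℓ) + (a + b))
                                      (trans (put-here (f ℓ) s) (sz-small s-small))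
                                      (put-elsewhere ℓ (Fin.<⇒≢ s<ℓ)) ⟩
      load f (f ℓ) + (S + 0)      ≡⟨ cong (load f (f ℓ) +_) (+-identityʳ S) ⟩
      load f (f ℓ) + S            ≤⟨ +-mono-≤ (proj₁ valid (f ℓ)) (S≤L S) ⟩
      bin (f ℓ) + Lsz S           ∎)
      where open ≤-Reasoning

    not-at-ℓ : ∀ {x i} → Empty g x → Later g x i → x ≢ f ℓ
    not-at-ℓ empty _ refl = empty s g-s

    used⊆ : ∀ {x} → Used g x → Used f x
    used⊆ used with used-g used
    ... | inj₁ used-f = used-f
    ... | inj₂ refl = ℓ , refl

    Φ-g<Φ-f : Φ g < Φ f
    Φ-g<Φ-f = cancel-<
      (subst₂ (λ a b → Φ g + (a * toℕ (f s) + b * toℕ (f ℓ)) ≡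
                       Φ f + (a * toℕ (f ℓ) + b * toℕ (f s)))
              (sz-small s-small) (sz-large ℓ-large) (weight-move₂ moment f (f ℓ) (f s) s≢ℓ))
      (rearrangement (S<L 1<S) s<ℓ)

  shift-into-gap : 1 < S → (∀ x → S ≤ bin x × bin x ≤ Msz S) → ∀ {f} → Optimal f →
                   ∀ {s j′ ℓ₀} → item s ≡ small → Lsz S ∸ S ≤ space f (f s) →
                   Empty f j′ → toℕ (f s) < toℕ j′ →
                   (∀ {x} → Empty f x → toℕ (f s) < toℕ x → toℕ j′ ≤ toℕ x) →
                   toℕ j′ < toℕ (f ℓ₀) → ⊥
  shift-into-gap 1<S bin-range {f} (valid@(packs , compact) , cheapest) {s} {j′} {ℓ₀}
                 s-small room empty′ s<j′ least j′<ℓ₀ =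
    <⇒≱ cost-g<cost-f (cheapest g (is-packing fits-at-j′ , compact-g not-at-K no-gap))
    where
    ℓ : Fin n
    ℓ = argmax (toℕ ∘ f) s (allFin n)
    K : Fin m
    K = f ℓ
    last : ∀ k → toℕ (f k) ≤ toℕ K
    last k = All.lookup (f[xs]≤f[argmax] s (allFin n)) (∈-allFin k)

    j′<K : toℕ j′ < toℕ K
    j′<K = <-≤-trans j′<ℓ₀ (last ℓ₀)

    large-after-j′ : ∀ k → toℕ j′ < toℕ (f k) → item k ≡ large
    large-after-j′ k later = large-if-exceeds (proj₁ (bin-range j′)) (compact j′ empty′ k later)

    ℓ-large : item ℓ ≡ large
    ℓ-large = large-after-j′ ℓ j′<K

    alone : ∀ {k} → f k ≡ K → k ≡ ℓ
    alone {k} fk≡K with k Fin.≟ ℓ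
    ... | yes k≡ℓ = k≡ℓ
    ... | no k≢ℓ = ⊥-elim (<⇒≱ (M<L+L 1<S) (begin
      Lsz S + Lsz S   ≡⟨ cong₂ _+_ (sz-large (large-after-j′ k (subst (λ y → toℕ j′ < toℕ y)
                                                                         (sym fk≡K) j′<K)))
                                   (sz-large ℓ-large) ⟨
      sz k + sz ℓ     ≤⟨ load-≥-members f k≢ℓ fk≡K refl ⟩
      load f K        ≤⟨ packs K ⟩
      bin K           ≤⟨ proj₂ (bin-range K) ⟩
      Msz S           ∎))
      where open ≤-Reasoning

    open Exchange valid s-small room ℓ-large (<-trans s<j′ j′<K) s<j′

    fits-at-j′ : load g j′ ≤ bin j′
    fits-at-j′ = begin
      load g j′                               ≤⟨ load-g-≤ j′ ⟩
      load f j′ + (put j′ s j′ + put j′ ℓ (f s)) ≡⟨ cong₂ (λ a b → a + (b + put j′ ℓ (f s)))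
                                                   (load-empty f empty′) (put-here j′ s) ⟩
      sz s + put j′ ℓ (f s)                    ≡⟨ cong₂ _+_ (sz-small s-small)
                                                            (put-elsewhere ℓ (Fin.<⇒≢ s<j′)) ⟩
      S + 0                                    ≡⟨ +-identityʳ S ⟩
      S                                        ≤⟨ proj₁ (bin-range j′) ⟩
      bin j′                                   ∎
      where open ≤-Reasoning

    g-≤-K : ∀ k → toℕ (g k) ≤ toℕ K
    g-≤-K k with k Fin.≟ s | k Fin.≟ ℓ
    ... | yes refl | _ = subst (λ y → toℕ y ≤ toℕ K) (sym g-s) (<⇒≤ j′<K)
    ... | no _ | yes refl = subst (λ y → toℕ y ≤ toℕ K) (sym g-ℓ) (last s)
    ... | no k≢s | no k≢ℓ = subst (λ y → toℕ y ≤ toℕ K) (sym (g-other k≢s k≢ℓ)) (last k)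

    not-at-K : ∀ {x i} → Empty g x → Later g x i → x ≢ K
    not-at-K {i = i} _ later refl = <⇒≱ later (g-≤-K i)

    no-gap : ∀ {x} → Empty f x → toℕ (f s) < toℕ x → toℕ x < toℕ j′ → ⊥
    no-gap empty s<x x<j′ = <⇒≱ x<j′ (least empty s<x)

    K-emptied : Empty g K
    K-emptied k gk≡K with k Fin.≟ s | k Fin.≟ ℓ
    ... | yes refl | _ = Fin.<⇒≢ j′<K (trans (sym g-s) gk≡K)
    ... | no _ | yes refl = Fin.<⇒≢ (<-trans s<j′ j′<K) (trans (sym g-ℓ) gk≡K)
    ... | no k≢s | no k≢ℓ = k≢ℓ (alone (trans (sym (g-other k≢s k≢ℓ)) gk≡K))

    bin-j′<bin-K : bin j′ < bin K
    bin-j′<bin-K = <-≤-trans (compact j′ empty′ ℓ j′<K) (≤-trans (load-≥-member f ℓ) (packs K))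

    cost-g<cost-f : cost g < cost f
    cost-g<cost-f = +-cancelʳ-< (bin K) _ _
      (≤-<-trans (cost-exchange (ℓ , refl) K-emptied used-g) (+-monoʳ-< (cost f) bin-j′<bin-K))

  no-bad : 1 < S → (∀ x → S ≤ bin x × bin x ≤ Msz S) → ∀ {f} → ΦOptimal f → ∀ j → ¬ Bad f j
  no-bad 1<S bin-range {f} f-opt _ ((s , refl , s-small) , room , (ℓ₀ , s<ℓ₀ , ℓ₀-large))
    with Fin.any? (λ x → Empty? f x ×-dec f s Fin.<? x ×-dec x Fin.<? f ℓ₀)
  ... | yes (x₀ , empty₀ , s<x₀ , x₀<ℓ₀) =
    let j′ , (empty′ , s<j′) , least =
          ∃-minimal {P = λ x → Empty f x × toℕ (f s) < toℕ x} toℕ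
            (λ c → Fin.any? (λ x → (Empty? f x ×-dec f s Fin.<? x) ×-dec toℕ x <? c))
            (empty₀ , s<x₀)
    in shift-into-gap 1<S bin-range (proj₁ f-opt) s-small room empty′ s<j′
                      (λ empty s<x → least (empty , s<x)) (≤-<-trans (least (empty₀ , s<x₀)) x₀<ℓ₀)
  ... | no no-gap = swap-with-later-large 1<S f-opt s-small room ℓ₀-large s<ℓ₀
                      (λ empty s<x x<ℓ₀ → no-gap (_ , empty , s<x , x<ℓ₀))

open D using (IsPacking; Optimal; Thrifty; Bad)

lemma3 : (S : ℕ) → 1 < S →
    (n m : ℕ) (item : Fin n → Item) (bin : Fin m → ℕ) →
    (∀ j → S ≤ bin j × bin j ≤ Msz S) →
    (∃ λ f → IsPacking S item bin f) →
    ∃ λ f → Optimal S item bin f × Thrifty S item bin f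
    × (∀ j → Bad S item bin f j → ⊥)
lemma3 S 1<S n m item bin bin-range (f₀ , packs₀) =
  let open Packings S item bin
      0<S : 0 < S
      0<S = <-trans z<s 1<S
      _ , valid₀ = valid-exists 0<S {f₀} packs₀
      f , f-opt = Φ-optimal-exists valid₀
  in f , proj₁ f-opt , thrifty 0<S f-opt , no-bad 1<S bin-range f-opt
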